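{- Let $G$ be a mixed graph. Construct a digraph $G'$ from $G$ as follows: replace every directed edge $(x,y)$ of $G$ by a new vertex $z$ and the two edges $(x,z),(z,y)$; replace every undirected edge $\{x,y\}$ of $G$ (with an arbitrary order of $x,y$) by three new vertices $z,u,v$ and the seven edges $(x,z),(z,x),(z,u),(u,v),(v,y),(y,u),(v,z)$. Let $T_1,\dots,T_k$ be the $2$-edge twinless strongly connected components of $G'$. Then the nonempty sets among $T_1\cap V(G),\dots,T_k\cap V(G)$ are exactly the edge-resilient strongly orientable blocks of $G$.
   Context: A mixed graph $G$ has both undirected edges $\{u,v\}$ and directed edges $(u,v)$. An orientation of $G$ is obtained by replacing each undirected edge $\{u,v\}$ by exactly one of $(u,v)$ or $(v,u)$. The edge-resilient strongly orientable blocks of $G$ are the maximal sets $C\subseteq V(G)$ such that for every edge $e$ of $G$ (directed or undirected) there is an orientation $R$ of $G\setminus e$ in which all vertices of $C$ are pairwise strongly connected. Two edges $(x,y),(y,x)$ are twin edges. A digraph is twinless strongly connected if it has a strongly connected spanning subgraph with no pair of twin edges; its twinless strongly connected components (TSCCs) are its maximal twinless strongly connected subgraphs. A $2$-edge twinless strongly connected component of a digraph $D$ is a maximal vertex set $C$ such that any two vertices of $C$ lie in the same TSCC of $D\setminus e$ for every edge $e$ of $D$. -}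

module Defs where

open import Level using (0ℓ)
open import Data.Nat using (ℕ)
open import Data.Fin using (Fin; zero; suc)
open import Data.Unit using (⊤; tt)
open import Data.Empty using (⊥)
open import Data.Sum using (_⊎_; inj₁; inj₂)
open import Data.Product using (Σ; Σ-syntax; ∃; ∃-syntax; _×_; _,_; swap)
open import Data.List using (List; []; _∷_; length; lookup; removeAt; allFin; concatMap)
open import Data.List.Membership.Propositional using (_∈_)
open import Data.List.Relation.Unary.All using (All)
open import Data.List.Relation.Binary.Sublist.Propositional using () renaming (_⊆_ to _⊑_)
open import Relation.Unary using (Pred; _⊆_) renaming (_∈_ to _∈ₚ_)
open import Relation.Binary.PropositionalEquality using (_≡_; _≢_)

-- Digraphs (multi-digraphs): a vertex type W and a list of arcs.
-- Arcs are identified by their position in the list.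

Arcs : Set → Set
Arcs W = List (W × W)

data Reach {W : Set} (A : Arcs W) : W → W → Set where
  here : ∀ {x} → Reach A x x
  step : ∀ {x z y} → (x , z) ∈ A → Reach A z y → Reach A x y

TwinFree : {W : Set} → Arcs W → Set
TwinFree H = ∀ i j → i ≢ j → lookup H i ≡ swap (lookup H j) → ⊥

-- The subgraph of D induced on S is twinless strongly connected:
-- it has a spanning subgraph H (a sub-multiset of the arcs of D with both
-- endpoints in S) that is strongly connected on S and has no twin pair.
TwinlessSC : {W : Set} → Arcs W → Pred W 0ℓ → Set
TwinlessSC {W} D S =
  Σ[ H ∈ Arcs W ] (H ⊑ D) × All (λ a → Σ.proj₁ a ∈ₚ S × Σ.proj₂ a ∈ₚ S) H
    × TwinFree H × (∀ x y → x ∈ₚ S → y ∈ₚ S → Reach H x y)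

IsTSCC : {W : Set} → Arcs W → Pred W 0ℓ → Set₁
IsTSCC D S = TwinlessSC D S × (∀ S' → S ⊆ S' → TwinlessSC D S' → S' ⊆ S)

SameTSCC : {W : Set} → Arcs W → W → W → Set₁
SameTSCC D x y = ∃[ S ] IsTSCC D S × x ∈ₚ S × y ∈ₚ S

TwoEdgeTwinless : {W : Set} → Arcs W → Pred W 0ℓ → Set₁
TwoEdgeTwinless D C =
  ∀ x y → x ∈ₚ C → y ∈ₚ C → (e : Fin (length D)) → SameTSCC (removeAt D e) x y

Is2eTSCC : {W : Set} → Arcs W → Pred W 0ℓ → Set₁
Is2eTSCC D C =
  TwoEdgeTwinless D C × (∀ C' → C ⊆ C' → TwoEdgeTwinless D C' → C' ⊆ C)

-- Mixed graphs on vertex set Fin n: a list of edges, each directed or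
-- undirected (the undirected edge {x,y} is stored with an arbitrary order).

data MEdge (n : ℕ) : Set where
  dir   : Fin n → Fin n → MEdge n
  undir : Fin n → Fin n → MEdge n

data Orients {n : ℕ} : List (MEdge n) → Arcs (Fin n) → Set where
  []    : Orients [] []
  dir∷  : ∀ {x y Es R} → Orients Es R → Orients (dir x y ∷ Es) ((x , y) ∷ R)
  fwd∷  : ∀ {x y Es R} → Orients Es R → Orients (undir x y ∷ Es) ((x , y) ∷ R)
  bwd∷  : ∀ {x y Es R} → Orients Es R → Orients (undir x y ∷ Es) ((y , x) ∷ R)

Resilient : {n : ℕ} → List (MEdge n) → Pred (Fin n) 0ℓ → Set
Resilient {n} E C = (e : Fin (length E)) →
  Σ[ R ∈ Arcs (Fin n) ] Orients (removeAt E e) R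
    × (∀ x y → x ∈ₚ C → y ∈ₚ C → Reach R x y)

IsERSOBlock : {n : ℕ} → List (MEdge n) → Pred (Fin n) 0ℓ → Set₁
IsERSOBlock E C = Resilient E C × (∀ D → C ⊆ D → Resilient E D → D ⊆ C)

Aux : {n : ℕ} → MEdge n → Set
Aux (dir _ _)   = ⊤
Aux (undir _ _) = Fin 3

V' : {n : ℕ} → List (MEdge n) → Set
V' {n} E = Fin n ⊎ Σ[ i ∈ Fin (length E) ] Aux (lookup E i)

gadget : {n : ℕ} {W : Set} → (Fin n → W) → (e : MEdge n) → (Aux e → W) → Arcs W
gadget old (dir x y) new = (old x , new tt) ∷ (new tt , old y) ∷ []
gadget old (undir x y) new =
  let z = new zero ; u = new (suc zero) ; v = new (suc (suc zero)) in
  (old x , z) ∷ (z , old x) ∷ (z , u) ∷ (u , v) ∷ (v , old y) ∷ (old y , u) ∷ (v , z) ∷ []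

G' : {n : ℕ} → (E : List (MEdge n)) → Arcs (V' E)
G' E = concatMap (λ i → gadget inj₁ (lookup E i) (λ a → inj₂ (i , a))) (allFin (length E))

-- Two vertices of a digraph lie in a common twinless strongly connected component iff they are
-- linked: strongly connected inside some subgraph without twin arcs. Linking is transitive, since
-- two such subgraphs can be merged without creating twins, and a single twinless subgraph (the
-- hull) witnesses every link of a vertex at once.
--
-- Every arc e of G' lies in the gadget of some edge i, and an orientation of G \ i lifts to a
-- twinless subgraph of G' \ e by replacing each oriented edge by a path through its gadget.
-- Conversely, each gadget has a cut arc occurring only once in G', without which the gadget
-- connects its two old vertices in neither direction. A twinless subgraph L of G' minus the cut
-- arc of edge i orients every other undirected edge {x,y} as x → y iff L uses (x,z); along any
-- path of L every vertex reached from an old vertex a satisfies an invariant that, on old vertices,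
-- is reachability from a in this orientation of G \ i.
--
-- So a set C of old vertices is resilient iff it is pairwise linked in G' \ e for every arc e,
-- and the blocks are the traces on V(G) of the classes of this relation, which are exactly the
-- 2-edge twinless strongly connected components of G'.
module Submission where

open import Defs
open import Level using (0ℓ)
open import Data.Bool using (Bool; true; false)
open import Data.Empty using (⊥; ⊥-elim)
open import Data.Fin using (Fin; zero; suc)
open import Data.Fin.Patterns using (0F; 1F; 2F)
import Data.Fin.Properties as Fin
open import Data.List using (List; []; _∷_; _++_; length; map; filter; lookup; removeAt; allFin; concatMap)
open import Data.List.Membership.Propositional using (_∈_; _∉_; lose; find)
open import Data.List.Membership.Propositional.Properties
  using (∈-filter⁺; ∈-filter⁻; ∈-++⁺ˡ; ∈-++⁺ʳ; ∈-++⁻; ∈-map⁺; ∈-map⁻; ∈-lookup; ∈-concatMap⁺; ∈-concatMap⁻; ∈-allFin)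
open import Data.List.Relation.Binary.Disjoint.Propositional using (Disjoint)
open import Data.List.Relation.Binary.Subset.Propositional using (_⊆_)
open import Data.List.Relation.Binary.Sublist.Propositional using ([]; _∷_; _∷ʳ_) renaming (_⊆_ to _⊑_)
import Data.List.Relation.Binary.Sublist.Propositional as Sublist
open import Data.List.Relation.Binary.Sublist.Propositional.Properties using (filter-⊆) renaming (map⁺ to ⊑-map⁺)
open import Data.List.Relation.Unary.All as All using (All; []; _∷_)
import Data.List.Relation.Unary.All.Properties as All
open import Data.List.Relation.Unary.AllPairs using ([]; _∷_)
import Data.List.Relation.Unary.AllPairs as AllPairs
import Data.List.Relation.Unary.AllPairs.Properties as AllPairs
open import Data.List.Relation.Unary.Any using (here; there)
import Data.List.Relation.Unary.Any as Any
open import Data.List.Relation.Unary.Any.Properties using (lookup-index)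
open import Data.List.Relation.Unary.Unique.Propositional using (Unique)
import Data.List.Relation.Unary.Unique.Propositional.Properties as Unique
import Data.List.Relation.Unary.Unique.DecPropositional as Unique
open import Data.Maybe using (Maybe; nothing; just)
import Data.Maybe.Properties as Maybe
open import Data.Nat using (ℕ)
open import Data.Product using (∃-syntax; _×_; _,_; proj₁; proj₂; swap)
import Data.Product as Prod
import Data.Product.Properties as Prod
open import Data.Sum using (_⊎_; inj₁; inj₂; [_,_]′)
import Data.Sum as Sum
open import Data.Sum.Properties using (inj₁-injective) renaming (≡-dec to ⊎-≡-dec)
open import Data.Unit using (tt)
import Data.Unit.Properties as Unit
open import Data.Vec.Functional using () renaming (_∷_ to _∷ᶠ_)
open import Function using (_∘_)
open import Function.Bundles using (_⇔_; mk⇔)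
open import Relation.Binary using (DecidableEquality)
open import Relation.Binary.PropositionalEquality using (_≡_; _≢_; refl; sym; trans; cong; subst)
open import Relation.Nullary using (¬_; Dec; yes; no; ¬?; does)
open import Relation.Nullary.Decidable using (_×-dec_; from-yes)
open import Relation.Unary using (Pred; Satisfiable; _≐_; _≐′_) renaming (_⊆_ to _⊆ₚ_; _∈_ to _∈ₚ_)

private variable
  V W : Set
  a : W × W
  A B H L M : Arcs W
  x y z : W

pattern #0 = here refl
pattern #1 = there #0
pattern #2 = there #1
pattern #3 = there #2
pattern #4 = there #3
pattern #5 = there #4
pattern #6 = there #5

sublists : List V → List (List V)
sublists [] = [] ∷ []
sublists (v ∷ vs) = map (v ∷_) (sublists vs) ++ sublists vs

filter∈sublists : ∀ {P : Pred V 0ℓ} (P? : ∀ v → Dec (P v)) vs → filter P? vs ∈ sublists vs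
filter∈sublists P? [] = here refl
filter∈sublists P? (v ∷ vs) with P? v
... | yes _ = ∈-++⁺ˡ (∈-map⁺ (v ∷_) (filter∈sublists P? vs))
... | no _ = ∈-++⁺ʳ (map (v ∷_) (sublists vs)) (filter∈sublists P? vs)

sublists-⊆ : ∀ (vs : List V) {us} → us ∈ sublists vs → us ⊆ vs
sublists-⊆ [] (here refl) ()
sublists-⊆ (v ∷ vs) m with ∈-++⁻ (map (v ∷_) (sublists vs)) m
... | inj₂ m′ = there ∘ sublists-⊆ vs m′
... | inj₁ m′ with ∈-map⁻ (v ∷_) m′
...   | us , m″ , refl = λ { (here refl) → here refl ; (there u) → there (sublists-⊆ vs m″ u) }

removeAt-⊆ : ∀ (xs : List V) e → removeAt xs e ⊆ xs
removeAt-⊆ (x ∷ xs) zero m = there m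
removeAt-⊆ (x ∷ xs) (suc e) (here eq) = here eq
removeAt-⊆ (x ∷ xs) (suc e) (there m) = there (removeAt-⊆ xs e m)

∈-removeAt⁺ : ∀ {v} (xs : List V) e → v ∈ xs → v ≢ lookup xs e → v ∈ removeAt xs e
∈-removeAt⁺ (x ∷ xs) zero (here refl) v≢x = ⊥-elim (v≢x refl)
∈-removeAt⁺ (x ∷ xs) zero (there m) _ = m
∈-removeAt⁺ (x ∷ xs) (suc e) (here eq) _ = here eq
∈-removeAt⁺ (x ∷ xs) (suc e) (there m) v≢ = there (∈-removeAt⁺ xs e m v≢)

lookup∉removeAt : ∀ {xs : List V} → Unique xs → ∀ e → lookup xs e ∉ removeAt xs e
lookup∉removeAt (x≢xs ∷ _) zero m = All.lookup x≢xs m refl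
lookup∉removeAt {xs = x ∷ xs} (x≢xs ∷ _) (suc e) (here eq) = All.lookup x≢xs (∈-lookup e) (sym eq)
lookup∉removeAt (_ ∷ unique) (suc e) (there m) = lookup∉removeAt unique e m

-- Reachability and twinless subgraphs

Reach-trans : Reach A x y → Reach A y z → Reach A x z
Reach-trans here q = q
Reach-trans (step m p) q = step m (Reach-trans p q)

Reach-∷ʳ : Reach A x y → (y , z) ∈ A → Reach A x z
Reach-∷ʳ p m = Reach-trans p (step m here)

Reach-mono : A ⊆ B → Reach A x y → Reach B x y
Reach-mono A⊆B here = here
Reach-mono A⊆B (step m p) = step (A⊆B m) (Reach-mono A⊆B p)

Reach-map : (f : W → V) → Reach A x y → Reach (map (Prod.map f f) A) (f x) (f y)
Reach-map f here = here
Reach-map f (step m p) = step (∈-map⁺ (Prod.map f f) m) (Reach-map f p)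

Reach-∷⁻ : Reach (a ∷ A) x y → Reach A x y ⊎ (Reach A x (proj₁ a) × Reach A (proj₂ a) y)
Reach-∷⁻ here = inj₁ here
Reach-∷⁻ (step (here refl) r) with Reach-∷⁻ r
... | inj₁ q = inj₂ (here , q)
... | inj₂ (_ , q) = inj₂ (here , q)
Reach-∷⁻ (step (there m) r) with Reach-∷⁻ r
... | inj₁ q = inj₁ (step m q)
... | inj₂ (p , q) = inj₂ (step m p , q)

Strong : Arcs W → W → W → Set
Strong H x y = Reach H x y × Reach H y x

Endpoint : W → W × W → Set
Endpoint w a = w ≡ proj₁ a ⊎ w ≡ proj₂ a

NoTwins : Arcs W → Set
NoTwins L = ∀ {a} → a ∈ L → swap a ∈ L → ⊥

NoTwins-⊆ : A ⊆ B → NoTwins B → NoTwins A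
NoTwins-⊆ A⊆B noTwins m m′ = noTwins (A⊆B m) (A⊆B m′)

NoTwins-map⁺ : ∀ {f : W → V} → (∀ {u v} → f u ≡ f v → u ≡ v) →
               NoTwins L → NoTwins (map (Prod.map f f) L)
NoTwins-map⁺ {L = L} f-injective noTwins m m′ with ∈-map⁻ _ m | ∈-map⁻ _ m′
... | a , a∈L , refl | b , b∈L , eq = noTwins a∈L (subst (_∈ L) (sym swap-a≡b) b∈L)
  where swap-a≡b = Prod.×-≡,≡→≡ (f-injective (cong proj₁ eq) , f-injective (cong proj₂ eq))

NoTwins-map⁻ : ∀ (f : W → V) → NoTwins (map (Prod.map f f) L) → NoTwins L
NoTwins-map⁻ f noTwins m m′ = noTwins (∈-map⁺ _ m) (∈-map⁺ _ m′)

TwinlessSubgraph : Arcs W → Arcs W → Set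
TwinlessSubgraph D L = L ⊆ D × NoTwins L

Linked : Arcs W → W → W → Set
Linked D x y = ∃[ L ] TwinlessSubgraph D L × Strong L x y

Linked-refl : ∀ (D : Arcs W) x → Linked D x x
Linked-refl D x = [] , ((λ ()) , (λ ())) , here , here

Linked-sym : ∀ {D : Arcs W} → Linked D x y → Linked D y x
Linked-sym (L , twinless , p , q) = L , twinless , q , p

ResilientlyLinked : Arcs W → W → W → Set
ResilientlyLinked D x y = ∀ e → Linked (removeAt D e) x y

module Twinless {W : Set} (_≟_ : DecidableEquality W) where

  _≟ₐ_ : DecidableEquality (W × W)
  _≟ₐ_ = Prod.≡-dec _≟_ _≟_

  open import Data.List.Membership.DecPropositional _≟ₐ_ using (_∈?_)

  Reach? : ∀ (A : Arcs W) x y → Dec (Reach A x y)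
  Reach? [] x y with x ≟ y
  ... | yes refl = yes here
  ... | no x≢y = no λ { here → x≢y refl ; (step () _) }
  Reach? (a ∷ A) x y with Reach? A x y | Reach? A x (proj₁ a) | Reach? A (proj₂ a) y
  ... | yes p | _ | _ = yes (Reach-mono there p)
  ... | no ¬p | yes p | yes q = yes (Reach-trans (Reach-mono there p) (step (here refl) (Reach-mono there q)))
  ... | no ¬p | no ¬q | _ = no λ r → [ ¬p , (λ pq → ¬q (proj₁ pq)) ]′ (Reach-∷⁻ r)
  ... | no ¬p | yes _ | no ¬q = no λ r → [ ¬p , (λ pq → ¬q (proj₂ pq)) ]′ (Reach-∷⁻ r)

  Strong? : ∀ (H : Arcs W) x y → Dec (Strong H x y)
  Strong? H x y = Reach? H x y ×-dec Reach? H y x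

  NoTwins? : ∀ (L : Arcs W) → Dec (NoTwins L)
  NoTwins? L with All.all? (λ a → ¬? (swap a ∈? L)) L
  ... | yes all = yes (λ m m′ → All.lookup all m m′)
  ... | no ¬all = no (λ noTwins → ¬all (All.tabulate noTwins))

  InComponent : Arcs W → W → Pred (W × W) 0ℓ
  InComponent H x a = Strong H x (proj₁ a) × Strong H x (proj₂ a)

  InComponent? : ∀ H x a → Dec (InComponent H x a)
  InComponent? H x a = Strong? H x (proj₁ a) ×-dec Strong? H x (proj₂ a)

  componentArcs : Arcs W → W → Arcs W
  componentArcs H x = filter (InComponent? H x) H

  componentArcs-⊆ : componentArcs H x ⊆ H
  componentArcs-⊆ m = proj₁ (∈-filter⁻ _ m)

  componentArcs-inside : a ∈ componentArcs H x → InComponent H x a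
  componentArcs-inside {H = H} m = proj₂ (∈-filter⁻ (InComponent? _ _) {xs = H} m)

  Reach-componentArcs : Reach H y z → Strong H x y → Strong H x z → Reach (componentArcs H x) y z
  Reach-componentArcs here _ _ = here
  Reach-componentArcs (step m r) (x⇝y , y⇝x) sz =
    let sw = Reach-∷ʳ x⇝y m , Reach-trans r (proj₂ sz) in
    step (∈-filter⁺ _ m ((x⇝y , y⇝x) , sw)) (Reach-componentArcs r sw sz)

  Strong-componentArcs : Strong H x y → Strong (componentArcs H x) x y
  Strong-componentArcs (p , q) =
    Reach-componentArcs p (here , here) (p , q) , Reach-componentArcs q (p , q) (here , here)

  -- Keep the strong component of x in H and add the arcs of M not inside it; twin arcs have the
  -- same endpoints, so they are both inside the component or both outside it.
  merge : W → Arcs W → Arcs W → Arcs W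
  merge x H M = componentArcs H x ++ filter (¬? ∘ InComponent? H x) M

  module _ {D : Arcs W} {x : W} where

    merge-twinless : TwinlessSubgraph D H → TwinlessSubgraph D M → TwinlessSubgraph D (merge x H M)
    merge-twinless {H = H} {M = M} (H⊆D , twinlessH) (M⊆D , twinlessM) = ⊆D , twinless
      where
      outside : a ∈ filter (¬? ∘ InComponent? H x) M → a ∈ M × ¬ InComponent H x a
      outside = ∈-filter⁻ (¬? ∘ InComponent? H x) {xs = M}
      ⊆D : merge x H M ⊆ D
      ⊆D m with ∈-++⁻ (componentArcs H x) m
      ... | inj₁ m′ = H⊆D (componentArcs-⊆ m′)
      ... | inj₂ m′ = M⊆D (proj₁ (outside m′))
      twinless : NoTwins (merge x H M)
      twinless m m′ with ∈-++⁻ (componentArcs H x) m | ∈-++⁻ (componentArcs H x) m′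
      ... | inj₁ k | inj₁ k′ = twinlessH (componentArcs-⊆ k) (componentArcs-⊆ k′)
      ... | inj₂ k | inj₂ k′ = twinlessM (proj₁ (outside k)) (proj₁ (outside k′))
      ... | inj₁ k | inj₂ k′ = proj₂ (outside k′) (Prod.swap (componentArcs-inside k))
      ... | inj₂ k | inj₁ k′ = proj₂ (outside k) (Prod.swap (componentArcs-inside k′))

  Strong-merge-left : Strong H x y → Strong (merge x H M) x y
  Strong-merge-left s = Prod.map (Reach-mono ∈-++⁺ˡ) (Reach-mono ∈-++⁺ˡ) (Strong-componentArcs s)

  Reach-merge-right : Reach M y z → Reach (merge x H M) y z
  Reach-merge-right here = here
  Reach-merge-right {x = x} {H = H} (step {x = y} {z = w} m r) with InComponent? H x (y , w)
  ... | yes (sy , sw) =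
    Reach-trans (Reach-mono ∈-++⁺ˡ (Reach-componentArcs (Reach-trans (proj₂ sy) (proj₁ sw)) sy sw))
                (Reach-merge-right r)
  ... | no outside = step (∈-++⁺ʳ _ (∈-filter⁺ _ m outside)) (Reach-merge-right r)

  Linked-trans : ∀ {D : Arcs W} → Linked D x y → Linked D y z → Linked D x z
  Linked-trans {x = x} (H , twinlessH , sxy) (M , twinlessM , p , q) =
    merge x H M , merge-twinless twinlessH twinlessM ,
    Reach-trans (proj₁ sxy′) (Reach-merge-right p) , Reach-trans (Reach-merge-right q) (proj₂ sxy′)
    where sxy′ = Strong-merge-left {M = M} sxy

  mergeAll : W → List (Arcs W) → Arcs W → Arcs W
  mergeAll x [] H = H
  mergeAll x (M ∷ Ms) H = mergeAll x Ms (merge x H M)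

  mergeAll-twinless : ∀ {D : Arcs W} {Ms} → All (TwinlessSubgraph D) Ms →
                      TwinlessSubgraph D H → TwinlessSubgraph D (mergeAll x Ms H)
  mergeAll-twinless [] twinlessH = twinlessH
  mergeAll-twinless (twinlessM ∷ twinlessMs) twinlessH =
    mergeAll-twinless twinlessMs (merge-twinless twinlessH twinlessM)

  Strong-mergeAll-left : ∀ Ms → Strong H x y → Strong (mergeAll x Ms H) x y
  Strong-mergeAll-left [] s = s
  Strong-mergeAll-left (M ∷ Ms) s = Strong-mergeAll-left Ms (Strong-merge-left {M = M} s)

  Strong-mergeAll-member : ∀ {Ms} → M ∈ Ms → Strong M x y → Strong (mergeAll x Ms H) x y
  Strong-mergeAll-member {Ms = M ∷ Ms} (here refl) (p , q) =
    Strong-mergeAll-left Ms (Reach-merge-right p , Reach-merge-right q)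
  Strong-mergeAll-member (there m) s = Strong-mergeAll-member m s

  -- Every link is witnessed by a twin-free sublist of D, and there are finitely many of those.
  hull : Arcs W → W → Arcs W
  hull D x = mergeAll x (filter NoTwins? (sublists D)) []

  hull-twinless : ∀ (D : Arcs W) x → TwinlessSubgraph D (hull D x)
  hull-twinless D x = mergeAll-twinless (All.tabulate twinless) ((λ ()) , (λ ()))
    where
    twinless : M ∈ filter NoTwins? (sublists D) → TwinlessSubgraph D M
    twinless m = let m′ , noTwins = ∈-filter⁻ NoTwins? {xs = sublists D} m in sublists-⊆ D m′ , noTwins

  Linked⇒Strong-hull : ∀ {D : Arcs W} → Linked D x y → Strong (hull D x) x y
  Linked⇒Strong-hull {D = D} (K , (K⊆D , noTwinsK) , p , q) =
    Strong-mergeAll-member (∈-filter⁺ NoTwins? (filter∈sublists (_∈? K) D) noTwinsK′)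
                           (Reach-mono K⊆K′ p , Reach-mono K⊆K′ q)
    where
    K′ = filter (_∈? K) D
    K⊆K′ : K ⊆ K′
    K⊆K′ m = ∈-filter⁺ (_∈? K) (K⊆D m) m
    noTwinsK′ : NoTwins K′
    noTwinsK′ = NoTwins-⊆ (λ m → proj₂ (∈-filter⁻ (_∈? K) {xs = D} m)) noTwinsK

  TwinFree⇒twinless : ∀ {D : Arcs W} → H ⊑ D → TwinFree H →
                      ∃[ L ] TwinlessSubgraph D L × (∀ {p q} → Reach H p q → Reach L p q)
  TwinFree⇒twinless {H = H} H⊑D twinFree = H₀ , (Sublist.lookup H⊑D ∘ fromH₀ , noTwins) , reach
    where
    nonLoop? : ∀ (a : W × W) → Dec (proj₁ a ≢ proj₂ a)
    nonLoop? a = ¬? (proj₁ a ≟ proj₂ a)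
    -- positional twin-freeness still allows a loop, which is its own twin
    H₀ = filter nonLoop? H
    fromH₀ : H₀ ⊆ H
    fromH₀ m = proj₁ (∈-filter⁻ nonLoop? {xs = H} m)
    noTwins : NoTwins H₀
    noTwins m m′ with Any.index (fromH₀ m) Fin.≟ Any.index (fromH₀ m′)
    ... | yes i≡j = proj₂ (∈-filter⁻ nonLoop? {xs = H} m) (cong proj₁ a≡swap-a)
      where
      a≡swap-a = trans (lookup-index (fromH₀ m))
                       (trans (cong (lookup H) i≡j) (sym (lookup-index (fromH₀ m′))))
    ... | no i≢j = twinFree _ _ i≢j (trans (sym (lookup-index (fromH₀ m))) (cong swap (lookup-index (fromH₀ m′))))
    reach : ∀ {p q} → Reach H p q → Reach H₀ p q
    reach here = here
    reach (step {x = p} {z = r} m rest) with p ≟ r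
    ... | yes refl = reach rest
    ... | no p≢r = step (∈-filter⁺ nonLoop? m p≢r) (reach rest)

  twinless⇒TwinlessSC : ∀ {D : Arcs W} (S : Pred W 0ℓ) → TwinlessSubgraph D L →
                        (∀ {a} → a ∈ L → proj₁ a ∈ₚ S × proj₂ a ∈ₚ S) →
                        (∀ p q → p ∈ₚ S → q ∈ₚ S → Reach L p q) → TwinlessSC D S
  twinless⇒TwinlessSC {L = L} {D = D} S (L⊆D , noTwins) inside reach =
    L₀ , filter-⊆ (_∈? L) D , All.tabulate (inside ∘ toL) , twinFree ,
    λ p q sp sq → Reach-mono (λ m → ∈-filter⁺ (_∈? L) (L⊆D m) m) (reach p q sp sq)
    where
    L₀ = filter (_∈? L) D
    toL : L₀ ⊆ L
    toL m = proj₂ (∈-filter⁻ (_∈? L) {xs = D} m)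
    twinFree : TwinFree L₀
    twinFree i j _ eq = noTwins (toL (∈-lookup j)) (subst (_∈ L) eq (toL (∈-lookup i)))

  SameTSCC⇒Linked : ∀ {D : Arcs W} → SameTSCC D x y → Linked D x y
  SameTSCC⇒Linked (S , ((H , H⊑D , _ , twinFree , reach) , _) , x∈S , y∈S) =
    let L , twinless , H⇒L = TwinFree⇒twinless H⊑D twinFree in
    L , twinless , H⇒L (reach _ _ x∈S y∈S) , H⇒L (reach _ _ y∈S x∈S)

  Linked⇒SameTSCC : ∀ {D : Arcs W} → Linked D x y → SameTSCC D x y
  Linked⇒SameTSCC {x = x} {y = y} {D = D} linked =
    Strong (hull D x) x , (isTwinlessSC , maximal) , (here , here) , Linked⇒Strong-hull linked
    where
    isTwinlessSC : TwinlessSC D (Strong (hull D x) x)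
    isTwinlessSC =
      twinless⇒TwinlessSC {L = componentArcs (hull D x) x} _
        (proj₁ (hull-twinless D x) ∘ componentArcs-⊆ , NoTwins-⊆ componentArcs-⊆ (proj₂ (hull-twinless D x)))
        componentArcs-inside
        (λ p q sp sq → Reach-componentArcs (Reach-trans (proj₂ sp) (proj₁ sq)) sp sq)
    maximal : ∀ S → Strong (hull D x) x ⊆ₚ S → TwinlessSC D S → S ⊆ₚ Strong (hull D x) x
    maximal S hull⊆S (H , H⊑D , _ , twinFree , reach) w∈S =
      let L , twinless , H⇒L = TwinFree⇒twinless H⊑D twinFree
          x∈S = hull⊆S (here , here) in
      Linked⇒Strong-hull (L , twinless , H⇒L (reach _ _ x∈S w∈S) , H⇒L (reach _ _ w∈S x∈S))

  ResilientlyLinked-class : ∀ (D : Arcs W) x → Is2eTSCC D (ResilientlyLinked D x)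
  ResilientlyLinked-class D x =
    (λ u v xu xv e → Linked⇒SameTSCC (Linked-trans (Linked-sym (xu e)) (xv e))) ,
    λ C class⊆C twoEdge {v} v∈C e →
      SameTSCC⇒Linked (twoEdge x v (class⊆C (λ e → Linked-refl (removeAt D e) x)) v∈C e)

  Is2eTSCC⇒ResilientlyLinked : ∀ {D : Arcs W} {T} → Is2eTSCC D T →
                               ∀ {u v} → T u → T v → ResilientlyLinked D u v
  Is2eTSCC⇒ResilientlyLinked (twoEdge , _) u∈T v∈T e = SameTSCC⇒Linked (twoEdge _ _ u∈T v∈T e)

-- Orientations

module _ {n : ℕ} where

  orient : MEdge n → Bool → Fin n × Fin n
  orient (dir x y) _ = x , y
  orient (undir x y) true = x , y
  orient (undir x y) false = y , x

  Choice : List (MEdge n) → Set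
  Choice E = Fin (length E) → Bool

  private
    Orients-∷⁻ : ∀ {d Es r R} → Orients (d ∷ Es) (r ∷ R) → ∃[ b ] r ≡ orient d b × Orients Es R
    Orients-∷⁻ (dir∷ o) = true , refl , o
    Orients-∷⁻ (fwd∷ o) = true , refl , o
    Orients-∷⁻ (bwd∷ o) = false , refl , o

    Orients-∷⁺ : ∀ d b {Es R} → Orients Es R → Orients (d ∷ Es) (orient d b ∷ R)
    Orients-∷⁺ (dir x y) b o = dir∷ o
    Orients-∷⁺ (undir x y) true o = fwd∷ o
    Orients-∷⁺ (undir x y) false o = bwd∷ o

  Orients⇒choice : ∀ E {R} → Orients E R →
                   ∃[ c ] (∀ {a} → a ∈ R → ∃[ j ] a ≡ orient (lookup E j) (c j))
  Orients⇒choice [] [] = (λ ()) , λ ()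
  Orients⇒choice (d ∷ E) {r ∷ R} o with Orients-∷⁻ o
  ... | b , refl , o′ with Orients⇒choice E o′
  ...   | c , chosen = b ∷ᶠ c , λ { (here refl) → zero , refl ; (there m) → let j , eq = chosen m in suc j , eq }

  Orients-removeAt⇒choice : ∀ E i {R} → Orients (removeAt E i) R →
                            ∃[ c ] (∀ {a} → a ∈ R → ∃[ j ] j ≢ i × a ≡ orient (lookup E j) (c j))
  Orients-removeAt⇒choice (d ∷ E) zero o with Orients⇒choice E o
  ... | c , chosen = true ∷ᶠ c , λ m → let j , eq = chosen m in suc j , (λ ()) , eq
  Orients-removeAt⇒choice (d ∷ E) (suc i) {r ∷ R} o with Orients-∷⁻ o
  ... | b , refl , o′ with Orients-removeAt⇒choice E i o′
  ...   | c , chosen = b ∷ᶠ c , λ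
    { (here refl) → zero , (λ ()) , refl
    ; (there m) → let j , j≢i , eq = chosen m in suc j , j≢i ∘ Fin.suc-injective , eq }

  choice⇒Orients : ∀ E (c : Choice E) → ∃[ R ] Orients E R × (∀ j → orient (lookup E j) (c j) ∈ R)
  choice⇒Orients [] c = [] , [] , λ ()
  choice⇒Orients (d ∷ E) c with choice⇒Orients E (c ∘ suc)
  ... | R , o , chosen = orient d (c zero) ∷ R , Orients-∷⁺ d (c zero) o ,
                         λ { zero → here refl ; (suc j) → there (chosen j) }

  choice⇒Orients-removeAt : ∀ E i (c : Choice E) →
                            ∃[ R ] Orients (removeAt E i) R × (∀ j → j ≢ i → orient (lookup E j) (c j) ∈ R)
  choice⇒Orients-removeAt (d ∷ E) zero c with choice⇒Orients E (c ∘ suc)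
  ... | R , o , chosen = R , o , λ { zero 0≢0 → ⊥-elim (0≢0 refl) ; (suc j) _ → chosen j }
  choice⇒Orients-removeAt (d ∷ E) (suc i) c with choice⇒Orients-removeAt E i (c ∘ suc)
  ... | R , o , chosen = orient d (c zero) ∷ R , Orients-∷⁺ d (c zero) o ,
                         λ { zero _ → here refl ; (suc j) j≢i → there (chosen j (j≢i ∘ cong suc)) }

-- The gadgets of G'

module _ {n : ℕ} where

  gadget-map : ∀ (f : W → V) (old : Fin n → W) d nw →
               gadget (f ∘ old) d (f ∘ nw) ≡ map (Prod.map f f) (gadget old d nw)
  gadget-map f old (dir x y) nw = refl
  gadget-map f old (undir x y) nw = refl

  Aux-≟ : ∀ (d : MEdge n) → DecidableEquality (Aux d)
  Aux-≟ (dir _ _) = Unit._≟_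
  Aux-≟ (undir _ _) = Fin._≟_

  gadget₀ : (d : MEdge n) → Arcs (Fin n ⊎ Aux d)
  gadget₀ d = gadget inj₁ d inj₂

  gadget₀-new : ∀ d → All (λ a → ∃[ k ] Endpoint (inj₂ k) a) (gadget₀ d)
  gadget₀-new (dir x y) = (_ , inj₂ refl) ∷ (_ , inj₁ refl) ∷ []
  gadget₀-new (undir x y) =
    (_ , inj₂ refl) ∷ (_ , inj₁ refl) ∷ (_ , inj₁ refl) ∷ (_ , inj₁ refl) ∷
    (_ , inj₁ refl) ∷ (_ , inj₂ refl) ∷ (_ , inj₁ refl) ∷ []

  eraseOld : {A : Set} → Fin n ⊎ A → Maybe A
  eraseOld = [ (λ _ → nothing) , just ]′

  -- Even with the old endpoints erased the arcs are pairwise distinct, which is decidable.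
  gadget₀-unique : ∀ d → Unique (gadget₀ d)
  gadget₀-unique d = Unique.map⁻ {f = Prod.map eraseOld eraseOld} (erased d)
    where
    unique? : {A : Set} → DecidableEquality A → (xs : List (Maybe A × Maybe A)) → Dec (Unique xs)
    unique? _≟_ = Unique.unique? (Prod.≡-dec (Maybe.≡-dec _≟_) (Maybe.≡-dec _≟_))
    erased : ∀ d → Unique (map (Prod.map eraseOld eraseOld) (gadget₀ d))
    erased d@(dir _ _) = from-yes (unique? Unit._≟_ (map (Prod.map eraseOld eraseOld) (gadget₀ d)))
    erased d@(undir _ _) = from-yes (unique? Fin._≟_ (map (Prod.map eraseOld eraseOld) (gadget₀ d)))

  -- A directed loop gets no path: its gadget is a pair of twins.
  orientPath : (d : MEdge n) → Bool → Arcs (Fin n ⊎ Aux d)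
  orientPath (dir x y) _ with x Fin.≟ y
  ... | yes _ = []
  ... | no _ = gadget₀ (dir x y)
  orientPath (undir x y) true =
    (inj₁ x , inj₂ 0F) ∷ (inj₂ 0F , inj₂ 1F) ∷ (inj₂ 1F , inj₂ 2F) ∷ (inj₂ 2F , inj₁ y) ∷ []
  orientPath (undir x y) false =
    (inj₂ 0F , inj₁ x) ∷ (inj₂ 1F , inj₂ 2F) ∷ (inj₁ y , inj₂ 1F) ∷ (inj₂ 2F , inj₂ 0F) ∷ []

  orientPath-⊑ : ∀ d b → orientPath d b ⊑ gadget₀ d
  orientPath-⊑ (dir x y) b with x Fin.≟ y
  ... | yes _ = _ ∷ʳ _ ∷ʳ []
  ... | no _ = Sublist.⊆-refl
  orientPath-⊑ (undir x y) true = refl ∷ _ ∷ʳ refl ∷ refl ∷ refl ∷ _ ∷ʳ _ ∷ʳ []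
  orientPath-⊑ (undir x y) false = _ ∷ʳ refl ∷ _ ∷ʳ refl ∷ _ ∷ʳ refl ∷ refl ∷ []

  orientPath-reach : ∀ d b {p q} → orient d b ≡ (p , q) → p ≢ q → Reach (orientPath d b) (inj₁ p) (inj₁ q)
  orientPath-reach (dir x y) b refl x≢y with x Fin.≟ y
  ... | yes x≡y = ⊥-elim (x≢y x≡y)
  ... | no _ = step #0 (step #1 here)
  orientPath-reach (undir x y) true refl _ = step #0 (step #1 (step #2 (step #3 here)))
  orientPath-reach (undir x y) false refl _ = step #2 (step #1 (step #3 (step #0 here)))

  orientPath-noTwins : ∀ d b → NoTwins (orientPath d b)
  orientPath-noTwins (dir x y) b with x Fin.≟ y
  ... | yes _ = λ ()
  ... | no x≢y = noTwins
    where
    noTwins : NoTwins (gadget₀ (dir x y))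
    noTwins #0 (there (here e)) = x≢y (inj₁-injective (cong proj₂ e))
    noTwins #1 (here e) = x≢y (sym (inj₁-injective (cong proj₁ e)))
    noTwins #1 (there (here ()))
  orientPath-noTwins (undir x y) b = NoTwins-map⁻ eraseOld (erased b)
    where
    noTwins? : (L : Arcs (Maybe (Fin 3))) → Dec (NoTwins L)
    noTwins? = Twinless.NoTwins? (Maybe.≡-dec Fin._≟_)
    erased : ∀ b → NoTwins (map (Prod.map eraseOld eraseOld) (orientPath (undir x y) b))
    erased true = from-yes (noTwins? (map (Prod.map eraseOld eraseOld) (orientPath (undir x y) true)))
    erased false = from-yes (noTwins? (map (Prod.map eraseOld eraseOld) (orientPath (undir x y) false)))

  -- The only arc entering z (directed) or v (undirected); without it the gadget connects its
  -- old vertices in neither direction.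
  cutArc : (Fin n → W) → (d : MEdge n) → (Aux d → W) → W × W
  cutArc old (dir x y) nw = old x , nw tt
  cutArc old (undir x y) nw = nw 1F , nw 2F

  cutArc∈gadget : ∀ (old : Fin n → W) d nw → cutArc old d nw ∈ gadget old d nw
  cutArc∈gadget old (dir x y) nw = #0
  cutArc∈gadget old (undir x y) nw = #3

module Construction {n : ℕ} (E : List (MEdge n)) where

  m : ℕ
  m = length E

  D : Arcs (V' E)
  D = G' E

  new : (j : Fin m) → Aux (lookup E j) → V' E
  new j k = inj₂ (j , k)

  embed : (j : Fin m) → Fin n ⊎ Aux (lookup E j) → V' E
  embed j = [ inj₁ , new j ]′

  embed-injective : ∀ j {u v} → embed j u ≡ embed j v → u ≡ v
  embed-injective j {inj₁ _} {inj₁ _} refl = refl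
  embed-injective j {inj₂ _} {inj₂ _} refl = refl

  embed≡new⇒≡ : ∀ {j j′} u {k} → embed j u ≡ new j′ k → j ≡ j′
  embed≡new⇒≡ (inj₂ _) refl = refl

  gadgetOf : Fin m → Arcs (V' E)
  gadgetOf j = gadget inj₁ (lookup E j) (new j)

  gadgetOf≡ : ∀ j → gadgetOf j ≡ map (Prod.map (embed j) (embed j)) (gadget₀ (lookup E j))
  gadgetOf≡ j = gadget-map (embed j) inj₁ (lookup E j) inj₂

  ∈G'⁻ : ∀ {a} → a ∈ D → ∃[ j ] a ∈ gadgetOf j
  ∈G'⁻ a∈D = Any.satisfied (∈-concatMap⁻ gadgetOf {xs = allFin m} a∈D)

  ∈G'⁺ : ∀ {a} j → a ∈ gadgetOf j → a ∈ D
  ∈G'⁺ j a∈gadget = ∈-concatMap⁺ gadgetOf {xs = allFin m} (lose (∈-allFin j) a∈gadget)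

  ∈gadgetOf⁻ : ∀ {a j} → a ∈ gadgetOf j →
               ∃[ a₀ ] a₀ ∈ gadget₀ (lookup E j) × a ≡ Prod.map (embed j) (embed j) a₀
  ∈gadgetOf⁻ {j = j} a∈gadget = ∈-map⁻ _ (subst (_ ∈_) (gadgetOf≡ j) a∈gadget)

  gadgetOf-new : ∀ {a j} → a ∈ gadgetOf j → ∃[ k ] Endpoint (new j k) a
  gadgetOf-new {j = j} a∈gadget with ∈gadgetOf⁻ a∈gadget
  ... | a₀ , a₀∈ , refl = let k , e = All.lookup (gadget₀-new _) a₀∈ in
                          k , Sum.map (cong (embed j)) (cong (embed j)) e

  gadgetOf-owner : ∀ {a j j′ k} → a ∈ gadgetOf j → Endpoint (new j′ k) a → j ≡ j′
  gadgetOf-owner a∈gadget e with ∈gadgetOf⁻ a∈gadget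
  ... | (p , q) , _ , refl = [ embed≡new⇒≡ p ∘ sym , embed≡new⇒≡ q ∘ sym ]′ e

  gadgetOf-disjoint : ∀ {a j j′} → a ∈ gadgetOf j → a ∈ gadgetOf j′ → j ≡ j′
  gadgetOf-disjoint a∈j a∈j′ = let _ , e = gadgetOf-new a∈j in sym (gadgetOf-owner a∈j′ e)

  gadgetOf-disjoint-swap : ∀ {a j j′} → a ∈ gadgetOf j → swap a ∈ gadgetOf j′ → j ≡ j′
  gadgetOf-disjoint-swap a∈j a∈j′ = let _ , e = gadgetOf-new a∈j in sym (gadgetOf-owner a∈j′ (Sum.swap e))

  G'-unique : Unique D
  G'-unique = Unique.concat⁺ (All.map⁺ (All.tabulate λ {j} _ → gadgetOf-unique j))
                             (AllPairs.map⁺ (AllPairs.map disjoint (Unique.allFin⁺ m)))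
    where
    gadgetOf-unique : ∀ j → Unique (gadgetOf j)
    gadgetOf-unique j = subst Unique (sym (gadgetOf≡ j))
                         (Unique.map⁺ pair-injective (gadget₀-unique (lookup E j)))
      where
      pair-injective : ∀ {a b} → Prod.map (embed j) (embed j) a ≡ Prod.map (embed j) (embed j) b → a ≡ b
      pair-injective eq = Prod.×-≡,≡→≡ (embed-injective j (cong proj₁ eq) , embed-injective j (cong proj₂ eq))
    disjoint : ∀ {j j′} → j ≢ j′ → Disjoint (gadgetOf j) (gadgetOf j′)
    disjoint j≢j′ (a∈j , a∈j′) = j≢j′ (gadgetOf-disjoint a∈j a∈j′)

  _≟_ : DecidableEquality (V' E)
  _≟_ = ⊎-≡-dec Fin._≟_ (Prod.≡-dec Fin._≟_ λ {j} → Aux-≟ (lookup E j))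

  open Twinless _≟_ public

  cutArcOf : Fin m → V' E × V' E
  cutArcOf i = cutArc inj₁ (lookup E i) (new i)

  cutPos : Fin m → Fin (length D)
  cutPos i = Any.index (∈G'⁺ i (cutArc∈gadget inj₁ (lookup E i) (new i)))

  cutArc∉removeAt : ∀ i → cutArcOf i ∉ removeAt D (cutPos i)
  cutArc∉removeAt i = subst (_∉ removeAt D (cutPos i)) (sym (lookup-index (∈G'⁺ i (cutArc∈gadget inj₁ _ _))))
                            (lookup∉removeAt G'-unique (cutPos i))

  pathOf : (j : Fin m) → Bool → Arcs (V' E)
  pathOf j b = map (Prod.map (embed j) (embed j)) (orientPath (lookup E j) b)

  pathOf-⊑ : ∀ j b → pathOf j b ⊑ gadgetOf j
  pathOf-⊑ j b = subst (pathOf j b ⊑_) (sym (gadgetOf≡ j)) (⊑-map⁺ _ (orientPath-⊑ (lookup E j) b))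

  module Lifting (i : Fin m) (c : Choice E) where

    kept : List (Fin m)
    kept = filter (λ j → ¬? (j Fin.≟ i)) (allFin m)

    lifted : Arcs (V' E)
    lifted = concatMap (λ j → pathOf j (c j)) kept

    ∈lifted⁻ : ∀ {a} → a ∈ lifted → ∃[ j ] j ≢ i × a ∈ pathOf j (c j)
    ∈lifted⁻ a∈lifted =
      let j , j∈kept , a∈path = find (∈-concatMap⁻ (λ j → pathOf j (c j)) {xs = kept} a∈lifted) in
      j , proj₂ (∈-filter⁻ (λ j → ¬? (j Fin.≟ i)) {xs = allFin m} j∈kept) , a∈path

    ∈lifted⁺ : ∀ {a} j → j ≢ i → a ∈ pathOf j (c j) → a ∈ lifted
    ∈lifted⁺ j j≢i a∈path =
      ∈-concatMap⁺ (λ j → pathOf j (c j)) {xs = kept} (lose (∈-filter⁺ _ (∈-allFin j) j≢i) a∈path)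

    lifted-twinless : ∀ e → lookup D e ∈ gadgetOf i → TwinlessSubgraph (removeAt D e) lifted
    lifted-twinless e removed∈gadget = ⊆removeAt , noTwins
      where
      ⊆removeAt : lifted ⊆ removeAt D e
      ⊆removeAt a∈lifted with ∈lifted⁻ a∈lifted
      ... | j , j≢i , a∈path = let a∈gadget = Sublist.lookup (pathOf-⊑ j (c j)) a∈path in
        ∈-removeAt⁺ D e (∈G'⁺ j a∈gadget) (λ { refl → j≢i (gadgetOf-disjoint a∈gadget removed∈gadget) })
      noTwins : NoTwins lifted
      noTwins a∈lifted a∈lifted′ with ∈lifted⁻ a∈lifted | ∈lifted⁻ a∈lifted′
      ... | j , _ , a∈path | j′ , _ , a∈path′
        with gadgetOf-disjoint-swap (Sublist.lookup (pathOf-⊑ j (c j)) a∈path)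
                                    (Sublist.lookup (pathOf-⊑ j′ (c j′)) a∈path′)
      ...   | refl = NoTwins-map⁺ (embed-injective j) (orientPath-noTwins (lookup E j) (c j)) a∈path a∈path′

    Reach-lifted : ∀ {R} → (∀ {a} → a ∈ R → ∃[ j ] j ≢ i × a ≡ orient (lookup E j) (c j)) →
                   ∀ {p q} → Reach R p q → Reach lifted (inj₁ p) (inj₁ q)
    Reach-lifted chosen here = here
    Reach-lifted chosen (step {x = p} {z = r} pr∈R rest) with p Fin.≟ r
    ... | yes refl = Reach-lifted chosen rest
    ... | no p≢r = let j , j≢i , eq = chosen pr∈R in
      Reach-trans (Reach-mono (∈lifted⁺ j j≢i)
                              (Reach-map (embed j) (orientPath-reach (lookup E j) (c j) (sym eq) p≢r)))
                  (Reach-lifted chosen rest)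

  lift-orientation : ∀ e → ∃[ i ] (∀ R → Orients (removeAt E i) R →
                     ∃[ L ] TwinlessSubgraph (removeAt D e) L ×
                            (∀ p q → Reach R p q → Reach L (inj₁ p) (inj₁ q)))
  lift-orientation e with ∈G'⁻ (∈-lookup e)
  ... | i , removed∈gadget = i , λ R orients →
    let c , chosen = Orients-removeAt⇒choice E i orients
        open Lifting i c
    in lifted , lifted-twinless e removed∈gadget , λ p q → Reach-lifted chosen

  module Projection (i : Fin m) (L : Arcs (V' E)) (twinless : TwinlessSubgraph (removeAt D (cutPos i)) L) where

    open import Data.List.Membership.DecPropositional _≟ₐ_ using (_∈?_)

    direction : (d : MEdge n) → (Aux d → V' E) → Bool
    direction (dir _ _) _ = true
    direction (undir x _) nw = does ((inj₁ x , nw 0F) ∈? L)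

    choice : Choice E
    choice j = direction (lookup E j) (new j)

    R : Arcs (Fin n)
    R = proj₁ (choice⇒Orients-removeAt E i choice)

    Orients-R : Orients (removeAt E i) R
    Orients-R = proj₁ (proj₂ (choice⇒Orients-removeAt E i choice))

    Agrees : (d : MEdge n) → (Aux d → V' E) → Set
    Agrees (dir x y) _ = (x , y) ∈ R
    Agrees (undir x y) nw = ((inj₁ x , nw 0F) ∈ L → (x , y) ∈ R) × ((nw 0F , inj₁ x) ∈ L → (y , x) ∈ R)

    agrees : ∀ j → j ≢ i → Agrees (lookup E j) (new j)
    agrees j j≢i =
      agrees-gadget (lookup E j) (new j) (proj₂ (proj₂ (choice⇒Orients-removeAt E i choice)) j j≢i)
      where
      agrees-gadget : ∀ d nw → orient d (direction d nw) ∈ R → Agrees d nw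
      agrees-gadget (dir x y) nw xy∈R = xy∈R
      agrees-gadget (undir x y) nw with (inj₁ x , nw 0F) ∈? L
      ... | yes xz∈L = λ xy∈R → (λ _ → xy∈R) , (λ zx∈L → ⊥-elim (proj₂ twinless xz∈L zx∈L))
      ... | no xz∉L = λ yx∈R → (λ xz∈L → ⊥-elim (xz∉L xz∈L)) , (λ _ → yx∈R)

    cutArc∉L : cutArcOf i ∉ L
    cutArc∉L k∈L = cutArc∉removeAt i (proj₁ twinless k∈L)

    -- A kept gadget is entered from x only through (x, z) and left towards x only through (z, x),
    -- and R orients its edge accordingly, so all its new vertices may stand for y (for x if
    -- directed). The gadget of i without its cut arc only leads back to x or y or into a dead end.
    module _ (a₀ : Fin n) where

      Kept : (d : MEdge n) → Aux d → Set
      Kept (dir x y) _ = Reach R a₀ x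
      Kept (undir x y) _ = Reach R a₀ y

      Removed : (d : MEdge n) → Aux d → Set
      Removed (dir x y) _ = ⊥
      Removed (undir x y) 0F = Reach R a₀ x
      Removed (undir x y) 1F = Reach R a₀ x ⊎ Reach R a₀ y
      Removed (undir x y) 2F = ⊥

      InGadget : (d : MEdge n) {j : Fin m} → Dec (j ≡ i) → Aux d → Set
      InGadget d (yes _) = Removed d
      InGadget d (no _) = Kept d

      Q : V' E → Set
      Q (inj₁ c) = Reach R a₀ c
      Q (inj₂ (j , k)) = InGadget (lookup E j) (j Fin.≟ i) k

      Q∘new : ∀ j → (j ≡ i × (Q ∘ new j) ≐′ Removed (lookup E j))
                  ⊎ (j ≢ i × (Q ∘ new j) ≐′ Kept (lookup E j))
      Q∘new j with j Fin.≟ i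
      ... | yes j≡i = inj₁ (j≡i , (λ _ q → q) , (λ _ q → q))
      ... | no j≢i = inj₂ (j≢i , (λ _ q → q) , (λ _ q → q))

      kept-step : ∀ d nw → (Q ∘ nw) ≐′ Kept d → Agrees d nw →
                  ∀ {w w′} → (w , w′) ∈ gadget inj₁ d nw → (w , w′) ∈ L → Q w → Q w′
      kept-step (dir x y) nw (to , from) xy∈R #0 _ q = from _ q
      kept-step (dir x y) nw (to , from) xy∈R #1 _ q = Reach-∷ʳ (to _ q) xy∈R
      kept-step (undir x y) nw (to , from) agree #0 xz∈L q = from _ (Reach-∷ʳ q (proj₁ agree xz∈L))
      kept-step (undir x y) nw (to , from) agree #1 zx∈L q = Reach-∷ʳ (to _ q) (proj₂ agree zx∈L)
      kept-step (undir x y) nw (to , from) _ #2 _ q = from _ (to _ q)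
      kept-step (undir x y) nw (to , from) _ #3 _ q = from _ (to _ q)
      kept-step (undir x y) nw (to , from) _ #4 _ q = to _ q
      kept-step (undir x y) nw (to , from) _ #5 _ q = from _ q
      kept-step (undir x y) nw (to , from) _ #6 _ q = from _ (to _ q)

      removed-step : ∀ d nw → (Q ∘ nw) ≐′ Removed d → cutArc inj₁ d nw ∉ L →
                     ∀ {w w′} → (w , w′) ∈ gadget inj₁ d nw → (w , w′) ∈ L → Q w → Q w′
      removed-step (dir x y) nw _ cut∉ #0 xz∈L _ = ⊥-elim (cut∉ xz∈L)
      removed-step (dir x y) nw (to , _) _ #1 _ q = ⊥-elim (to _ q)
      removed-step (undir x y) nw (to , from) _ #0 _ q = from _ q
      removed-step (undir x y) nw (to , from) _ #1 _ q = to _ q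
      removed-step (undir x y) nw (to , from) _ #2 _ q = from _ (inj₁ (to _ q))
      removed-step (undir x y) nw _ cut∉ #3 uv∈L _ = ⊥-elim (cut∉ uv∈L)
      removed-step (undir x y) nw (to , _) _ #4 _ q = ⊥-elim (to _ q)
      removed-step (undir x y) nw (to , from) _ #5 _ q = from _ (inj₂ q)
      removed-step (undir x y) nw (to , _) _ #6 _ q = ⊥-elim (to _ q)

      Q-closed : ∀ {w w′} → Reach L w w′ → Q w → Q w′
      Q-closed here q = q
      Q-closed (step a∈L rest) q with ∈G'⁻ (removeAt-⊆ D (cutPos i) (proj₁ twinless a∈L))
      ... | j , a∈gadget with Q∘new j
      ...   | inj₁ (refl , Q≐) = Q-closed rest (removed-step (lookup E i) (new i) Q≐ cutArc∉L a∈gadget a∈L q)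
      ...   | inj₂ (j≢i , Q≐) = Q-closed rest (kept-step (lookup E j) (new j) Q≐ (agrees j j≢i) a∈gadget a∈L q)

    Reach-R : ∀ p q → Reach L (inj₁ p) (inj₁ q) → Reach R p q
    Reach-R p q r = Q-closed p r here

  Resilient⇒ResilientlyLinked : ∀ {C} → Resilient E C →
                                ∀ {x y} → C x → C y → ResilientlyLinked D (inj₁ x) (inj₁ y)
  Resilient⇒ResilientlyLinked resilient {x} {y} x∈C y∈C e =
    let i , lifts = lift-orientation e
        R , orients , strong = resilient i
        L , twinless , lifted = lifts R orients
    in L , twinless , lifted x y (strong x y x∈C y∈C) , lifted y x (strong y x y∈C x∈C)

  ResilientlyLinked⇒Resilient : ∀ (C : Pred (Fin n) 0ℓ) x₀ →
                                (∀ y → C y → ResilientlyLinked D (inj₁ x₀) (inj₁ y)) → Resilient E C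
  ResilientlyLinked⇒Resilient C x₀ linked i =
    R , Orients-R , λ p q p∈C q∈C → Reach-R p q (Reach-trans (proj₂ (strong p∈C)) (proj₁ (strong q∈C)))
    where
    hullᵢ : Arcs (V' E)
    hullᵢ = hull (removeAt D (cutPos i)) (inj₁ x₀)
    open Projection i hullᵢ (hull-twinless _ _)
    strong : ∀ {y} → C y → Strong hullᵢ (inj₁ x₀) (inj₁ y)
    strong y∈C = Linked⇒Strong-hull (linked _ y∈C (cutPos i))

proposition2 : (n : ℕ) (E : List (MEdge n)) (C : Pred (Fin n) 0ℓ) → Satisfiable C →
    (IsERSOBlock E C ⇔ (∃[ T ] Is2eTSCC (G' E) T × (C ≐ (λ x → T (inj₁ x)))))
proposition2 n E C (x₀ , x₀∈C) = mk⇔ block⇒component component⇒block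
  where
  open Construction E
  Class : Pred (V' E) 0ℓ
  Class = ResilientlyLinked D (inj₁ x₀)

  block⇒component : IsERSOBlock E C → ∃[ T ] Is2eTSCC D T × (C ≐ (λ x → T (inj₁ x)))
  block⇒component (resilient , maximal) =
    Class , ResilientlyLinked-class D (inj₁ x₀) , Resilient⇒ResilientlyLinked resilient x₀∈C ,
    λ {y} x₀-y → maximal (λ v → C v ⊎ v ≡ y) inj₁
      (ResilientlyLinked⇒Resilient _ x₀ λ { v (inj₁ v∈C) → Resilient⇒ResilientlyLinked resilient x₀∈C v∈C
                                          ; _ (inj₂ refl) → x₀-y })
      (inj₂ refl)

  component⇒block : (∃[ T ] Is2eTSCC D T × (C ≐ (λ x → T (inj₁ x)))) → IsERSOBlock E C
  component⇒block (T , isT , C⊆T , T⊆C) =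
    ResilientlyLinked⇒Resilient C x₀ (λ _ y∈C → T-linked (C⊆T x₀∈C) (C⊆T y∈C)) ,
    λ C′ C⊆C′ resilient′ y∈C′ →
      T⊆C (proj₂ isT Class (T-linked (C⊆T x₀∈C)) (proj₁ (ResilientlyLinked-class D (inj₁ x₀)))
                   (Resilient⇒ResilientlyLinked resilient′ (C⊆C′ x₀∈C) y∈C′))
    where
    T-linked : ∀ {u v} → T u → T v → ResilientlyLinked D u v
    T-linked = Is2eTSCC⇒ResilientlyLinked {D = D} isT
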